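{- Let $X$ be a subset of an abelian group $\Gamma$, let $h \geq 2$ be an integer, and let $k$ be an integer with $h/2 \leq k \leq h$. Then $\mathcal{B}_h(X) = \mathcal{B}_{h,k}(X)$.
   Context: For a subset $A$ of an abelian group and integers $1 \leq k \leq h$, $A$ is a generalized Sidon set of order $(h,k)$ (a $B_{h,k}$-set) if whenever $a_1,\ldots,a_h,a'_1,\ldots,a'_h \in A$ satisfy $a_1+\cdots+a_h = a'_1+\cdots+a'_h$, there exist sets $I, I' \subseteq \{1,\ldots,h\}$ with $|I|=|I'|=k$ and a bijection $\tau: I' \to I$ such that $a'_{i'} = a_{\tau(i')}$ for all $i' \in I'$. A $B_h$-set (Sidon set of order $h$) is a $B_{h,h}$-set, i.e. equal sums of $h$ elements force the two $h$-tuples to be permutations of each other. $\mathcal{B}_h(X)$ denotes the collection of all finite $B_h$-sets contained in $X$, and $\mathcal{B}_{h,k}(X)$ the collection of all finite $B_{h,k}$-sets contained in $X$. -}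

module Defs where

open import Level using (Level; _⊔_)
open import Algebra.Bundles using (AbelianGroup)
open import Data.Nat using (ℕ; zero; suc)
open import Data.Fin using (Fin; zero; suc)
open import Data.List using (List)
open import Data.List.Relation.Unary.Any using (Any)
open import Data.List.Relation.Unary.All using (All)
open import Data.Product using (Σ; ∃; _×_; _,_)
open import Function.Definitions using (Injective)
open import Relation.Binary.PropositionalEquality using (_≡_)

module _ {c ℓ : Level} (G : AbelianGroup c ℓ) where
  open AbelianGroup G renaming (Carrier to Γ)

  sumT : ∀ {n} → (Fin n → Γ) → Γ
  sumT {zero}  a = ε
  sumT {suc n} a = a zero ∙ sumT (λ i → a (suc i))

  _∈A_ : Γ → List Γ → Set (c ⊔ ℓ)
  x ∈A A = Any (x ≈_) A

  -- A choice of index sets I, I' ⊆ {1..h} of size k together with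
  -- a bijection τ : I' → I is encoded by two injections σ, σ' : Fin k → Fin h
  -- (I = image σ, I' = image σ', τ = σ ∘ σ'⁻¹); the condition
  -- a'_{i'} = a_{τ(i')} becomes a' (σ' j) ≈ a (σ j) for all j.
  IsBhk : ℕ → ℕ → List Γ → Set (c ⊔ ℓ)
  IsBhk h k A =
    ∀ (a a' : Fin h → Γ) →
      (∀ i → a i ∈A A) → (∀ i → a' i ∈A A) →
      sumT a ≈ sumT a' →
      Σ (Fin k → Fin h) λ σ → Σ (Fin k → Fin h) λ σ' →
        Injective _≡_ _≡_ σ × Injective _≡_ _≡_ σ' ×
        (∀ j → a' (σ' j) ≈ a (σ j))

  IsBh : ℕ → List Γ → Set (c ⊔ ℓ)
  IsBh h A = IsBhk h h A

  InBh : ∀ {ℓx} → (Γ → Set ℓx) → ℕ → List Γ → Set (c ⊔ ℓ ⊔ ℓx)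
  InBh X h A = All X A × IsBh h A

  InBhk : ∀ {ℓx} → (Γ → Set ℓx) → ℕ → ℕ → List Γ → Set (c ⊔ ℓ ⊔ ℓx)
  InBhk X h k A = All X A × IsBhk h k A

{-# OPTIONS --safe #-}
module Submission where

-- Restricting the index sets shows that B_h-sets are B_{h,k}-sets.  Conversely, let A be a B_{h,k}-set
-- with h ≤ 2k.  Two m-tuples from A (1 ≤ m ≤ h) with equal sums share an entry: if h − m < k, pad both with
-- h − m copies of an entry of the first; at most h − m < k of the k matched positions of the second padded
-- tuple are padding, so one lies in the second tuple.  If h − m ≥ k then 2m ≤ h, and the claim for the
-- doubled tuples gives it for the original ones.  Cancelling a shared entry and inducting on m turns equal
-- sums into a permutation.

open import Defs
open import Level using (Level; _⊔_)
open import Algebra.Bundles using (AbelianGroup)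
open import Data.Nat using (ℕ; _≤_; _*_; zero; suc; _+_; _∸_; _<_; _<?_; z<s)
open import Data.List using (List)
open import Data.Nat.Properties
  using (+-cancelʳ-≤; +-identityʳ; *-monoʳ-≤; ≮⇒≥; <⇒≱; ∸-monoʳ-<; +-assoc; m+[n∸m]≡n; ≤-refl; ≤-trans; ≤-reflexive; n≤1+n; module ≤-Reasoning)
open import Data.Nat.Induction using (<-rec)
open import Data.Fin using (Fin; zero; suc; splitAt; _↑ʳ_; inject≤; punchIn; punchOut; _≟_)
open import Data.Fin.Properties using (any?; injective⇒≤; splitAt⁻¹-↑ʳ; inject≤-injective; punchIn-punchOut)
open import Data.Fin.Permutation using (Permutation′; _⟨$⟩ʳ_; insert)
import Data.Fin.Permutation as Perm
open import Data.Vec.Functional using (Vector; _++_; replicate; removeAt)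
open import Data.Vec.Functional.Relation.Unary.All using (All)
open import Data.Vec.Functional.Relation.Unary.All.Properties using (++⁺)
open import Data.Vec.Functional.Relation.Unary.Any using (Any)
import Data.List.Relation.Unary.Any as ListAny
open import Data.Sum using (_⊎_; inj₁; inj₂; [_,_]′)
open import Data.Product using (Σ; ∃; ∃₂; _×_; _,_; proj₁; proj₂; map₂)
open import Function using (_∘_; id)
open import Function.Bundles using (Injection)
open import Function.Definitions using (Injective)
open import Function.Properties.Inverse using (↔⇒↣)
open import Relation.Nullary using (Dec; yes; no; contradiction)
import Relation.Binary.PropositionalEquality as ≡
open ≡ using (_≡_)

injection-hits-↑ˡ : ∀ {k m n} → n < k → (f : Fin k → Fin (m + n)) → Injective _≡_ _≡_ f →
                    ∃₂ λ x j → splitAt m (f x) ≡ inj₁ j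
injection-hits-↑ˡ {k} {m} {n} n<k f f-inj with any? (λ x → isInj₁? (splitAt m (f x)))
  where
  isInj₁? : (s : Fin m ⊎ Fin n) → Dec (∃ λ j → s ≡ inj₁ j)
  isInj₁? (inj₁ j) = yes (j , ≡.refl)
  isInj₁? (inj₂ _) = no λ ()
... | yes hit  = hit
... | no  miss = contradiction (injective⇒≤ {f = proj₁ ∘ right} right-injective) (<⇒≱ n<k)
  where
  right : ∀ x → ∃ λ q → splitAt m (f x) ≡ inj₂ q
  right x with splitAt m (f x) in eq
  ... | inj₁ j = contradiction (x , j , eq) miss
  ... | inj₂ q = q , ≡.refl

  right-injective : Injective _≡_ _≡_ (proj₁ ∘ right)
  right-injective {x} {y} qx≡qy = f-inj (begin
    f x                   ≡⟨ splitAt⁻¹-↑ʳ (proj₂ (right x)) ⟨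
    m ↑ʳ proj₁ (right x)  ≡⟨ ≡.cong (m ↑ʳ_) qx≡qy ⟩
    m ↑ʳ proj₁ (right y)  ≡⟨ splitAt⁻¹-↑ʳ (proj₂ (right y)) ⟩
    f y                   ∎)
    where open ≡.≡-Reasoning

m+n≤2*k⇒k≤n⇒m≤n : ∀ {m n k} → m + n ≤ 2 * k → k ≤ n → m ≤ n
m+n≤2*k⇒k≤n⇒m≤n {m} {n} {k} m+n≤2k k≤n = +-cancelʳ-≤ n m n (begin
  m + n        ≤⟨ m+n≤2k ⟩
  2 * k        ≤⟨ *-monoʳ-≤ 2 k≤n ⟩
  n + (n + 0)  ≡⟨ ≡.cong (n +_) (+-identityʳ n) ⟩
  n + n        ∎)
  where open ≤-Reasoning

module _ {c ℓ : Level} (G : AbelianGroup c ℓ) where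
  open AbelianGroup G renaming (Carrier to Γ)
  open import Algebra.Properties.CommutativeMonoid.Sum commutativeMonoid using (sum; sum-cong-≗; sum-remove)
  open import Algebra.Properties.Group group using (∙-cancelˡ)
  open import Relation.Binary.Reasoning.Setoid setoid

  sumT≡sum : ∀ {n} (a : Vector Γ n) → sumT G a ≡ sum a
  sumT≡sum {zero}  a = ≡.refl
  sumT≡sum {suc n} a = ≡.cong (a zero ∙_) (sumT≡sum (a ∘ suc))

  sumT≈⇒sum≈ : ∀ {n} (u v : Vector Γ n) → sumT G u ≈ sumT G v → sum u ≈ sum v
  sumT≈⇒sum≈ u v = ≡.subst₂ _≈_ (sumT≡sum u) (sumT≡sum v)

  sum≈⇒sumT≈ : ∀ {n} (u v : Vector Γ n) → sum u ≈ sum v → sumT G u ≈ sumT G v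
  sum≈⇒sumT≈ u v = ≡.subst₂ _≈_ (≡.sym (sumT≡sum u)) (≡.sym (sumT≡sum v))

  tail-++ : ∀ {m n} (u : Vector Γ (suc m)) (v : Vector Γ n) → (u ++ v) ∘ suc ≡.≗ (u ∘ suc) ++ v
  tail-++ {m} u v i with splitAt m i
  ... | inj₁ _ = ≡.refl
  ... | inj₂ _ = ≡.refl

  sum-++ : ∀ {m n} (u : Vector Γ m) (v : Vector Γ n) → sum (u ++ v) ≈ sum u ∙ sum v
  sum-++ {zero}  u v = sym (identityˡ (sum v))
  sum-++ {suc m} u v = begin
    u zero ∙ sum ((u ++ v) ∘ suc)   ≡⟨ ≡.cong (u zero ∙_) (sum-cong-≗ (tail-++ u v)) ⟩
    u zero ∙ sum ((u ∘ suc) ++ v)   ≈⟨ ∙-congˡ (sum-++ (u ∘ suc) v) ⟩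
    u zero ∙ (sum (u ∘ suc) ∙ sum v) ≈⟨ assoc _ _ _ ⟨
    sum u ∙ sum v                    ∎

  sum-++-cong : ∀ {m n} (u u′ : Vector Γ m) (v v′ : Vector Γ n) →
                sum u ≈ sum u′ → sum v ≈ sum v′ → sum (u ++ v) ≈ sum (u′ ++ v′)
  sum-++-cong u u′ v v′ eqᵤ eqᵥ = begin
    sum (u ++ v)     ≈⟨ sum-++ u v ⟩
    sum u ∙ sum v    ≈⟨ ∙-cong eqᵤ eqᵥ ⟩
    sum u′ ∙ sum v′  ≈⟨ sum-++ u′ v′ ⟨
    sum (u′ ++ v′)   ∎

  _∈ᵥ_ : ∀ {n} → Γ → Vector Γ n → Set ℓ
  x ∈ᵥ v = Any (x ≈_) v

  _⊆ᵥ_ : ∀ {m n} → Vector Γ m → Vector Γ n → Set ℓ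
  u ⊆ᵥ v = All (_∈ᵥ v) u

  ⊆ᵥ-refl : ∀ {n} (v : Vector Γ n) → v ⊆ᵥ v
  ⊆ᵥ-refl v i = i , refl

  Meets : ∀ {m n} → Vector Γ m → Vector Γ n → Set ℓ
  Meets u u′ = Any (_∈ᵥ u) u′

  Meets-mono : ∀ {m m′ n n′} {u : Vector Γ m} {u′ : Vector Γ m′} {w : Vector Γ n} {w′ : Vector Γ n′} →
               u ⊆ᵥ w → u′ ⊆ᵥ w′ → Meets u u′ → Meets w w′
  Meets-mono u⊆w u′⊆w′ (q , p , u′q≈up) with u⊆w p | u′⊆w′ q
  ... | i , up≈wi | j , u′q≈w′j = j , i , trans (sym u′q≈w′j) (trans u′q≈up up≈wi)

  _⊆ᴬ_ : ∀ {n} → Vector Γ n → List Γ → Set (c ⊔ ℓ)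
  v ⊆ᴬ A = All (λ x → _∈A_ G x A) v

  ++-⊆ᵥ : ∀ {m n o} {u : Vector Γ m} {v : Vector Γ n} {w : Vector Γ o} → u ⊆ᵥ w → v ⊆ᵥ w → (u ++ v) ⊆ᵥ w
  ++-⊆ᵥ {u = u} {v} {w} = ++⁺ (_∈ᵥ w) {xs = u} {ys = v}

  ++-⊆ᴬ : ∀ {m n} {A : List Γ} {u : Vector Γ m} {v : Vector Γ n} → u ⊆ᴬ A → v ⊆ᴬ A → (u ++ v) ⊆ᴬ A
  ++-⊆ᴬ {A = A} {u} {v} = ++⁺ (λ x → _∈A_ G x A) {xs = u} {ys = v}

  ⊆ᵥ-⊆ᴬ : ∀ {m n} {A : List Γ} {u : Vector Γ m} {v : Vector Γ n} → u ⊆ᵥ v → v ⊆ᴬ A → u ⊆ᴬ A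
  ⊆ᵥ-⊆ᴬ u⊆v vA p with u⊆v p
  ... | i , up≈vi = ListAny.map (trans up≈vi) (vA i)

  insert-matches : ∀ {m} {b b′ : Vector Γ (suc m)} {i j} (π : Permutation′ m) → b′ j ≈ b i →
                   (∀ y → removeAt b′ j (π ⟨$⟩ʳ y) ≈ removeAt b i y) → ∀ x → b′ (insert i j π ⟨$⟩ʳ x) ≈ b x
  insert-matches {b = b} {b′} {i} {j} π b′j≈bi rest x with i ≟ x
  ... | yes ≡.refl = b′j≈bi
  ... | no  i≢x    = begin
    b′ (punchIn j (π ⟨$⟩ʳ punchOut i≢x))  ≈⟨ rest (punchOut i≢x) ⟩
    b (punchIn i (punchOut i≢x))          ≡⟨ ≡.cong b (punchIn-punchOut i≢x) ⟩
    b x                                   ∎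

  IsBhk-mono : ∀ {h k k′} {A : List Γ} → k′ ≤ k → IsBhk G h k A → IsBhk G h k′ A
  IsBhk-mono {k = k} {k′} k′≤k bhk a a′ aA a′A eq with bhk a a′ aA a′A eq
  ... | σ , σ′ , σ-injective , σ′-injective , matched =
    σ ∘ restrict , σ′ ∘ restrict ,
    restrict-injective ∘ σ-injective , restrict-injective ∘ σ′-injective ,
    matched ∘ restrict
    where
    restrict : Fin k′ → Fin k
    restrict j = inject≤ j k′≤k

    restrict-injective : Injective _≡_ _≡_ restrict
    restrict-injective = inject≤-injective k′≤k k′≤k _ _

  module _ {A : List Γ} where

    IsBhk-meetsPrefix : ∀ {m n k} → IsBhk G (m + n) k A → n < k →
                        (L : Vector Γ (m + n)) (b′ : Vector Γ m) (c′ : Vector Γ n) →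
                        L ⊆ᴬ A → (b′ ++ c′) ⊆ᴬ A → sum L ≈ sum (b′ ++ c′) → Meets L b′
    IsBhk-meetsPrefix bhk n<k L b′ c′ LA RA eq
      with bhk L (b′ ++ c′) LA RA (sum≈⇒sumT≈ L (b′ ++ c′) eq)
    ... | σ , σ′ , _ , σ′-injective , matched with injection-hits-↑ˡ n<k σ′ σ′-injective
    ... | x , j , σ′x∈b′ = j , σ x , (begin
      b′ j                ≡⟨ ≡.cong [ b′ , c′ ]′ σ′x∈b′ ⟨
      (b′ ++ c′) (σ′ x)   ≈⟨ matched x ⟩
      L (σ x)             ∎)

    EqualSumsMeet : ℕ → Set (c ⊔ ℓ)
    EqualSumsMeet m = ∀ (b b′ : Vector Γ m) → b ⊆ᴬ A → b′ ⊆ᴬ A → sum b ≈ sum b′ → Meets b b′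

    equalSumsMeet-pad : ∀ {m n k} → IsBhk G (suc m + n) k A → n < k → EqualSumsMeet (suc m)
    equalSumsMeet-pad {n = n} bhk n<k b b′ bA b′A eq =
      Meets-mono L⊆b (⊆ᵥ-refl b′)
        (IsBhk-meetsPrefix bhk n<k (b ++ pad) b′ pad (⊆ᵥ-⊆ᴬ L⊆b bA) (++-⊆ᴬ b′A padA)
          (sum-++-cong b b′ pad pad eq refl))
      where
      pad : Vector Γ n
      pad = replicate n (b zero)

      padA : pad ⊆ᴬ A
      padA _ = bA zero

      L⊆b : (b ++ pad) ⊆ᵥ b
      L⊆b = ++-⊆ᵥ (⊆ᵥ-refl b) (λ _ → zero , refl)

    equalSumsMeet-halve : ∀ {m} → EqualSumsMeet (m + m) → EqualSumsMeet m
    equalSumsMeet-halve meets b b′ bA b′A eq =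
      Meets-mono (++-⊆ᵥ (⊆ᵥ-refl b) (⊆ᵥ-refl b)) (++-⊆ᵥ (⊆ᵥ-refl b′) (⊆ᵥ-refl b′))
        (meets (b ++ b) (b′ ++ b′) (++-⊆ᴬ bA bA) (++-⊆ᴬ b′A b′A) (sum-++-cong b b′ b b′ eq eq))

    IsBhk⇒equalSumsMeet : ∀ {h k} → IsBhk G h k A → h ≤ 2 * k → ∀ {m} → suc m ≤ h → EqualSumsMeet (suc m)
    IsBhk⇒equalSumsMeet {h} {k} bhk h≤2k {m} m<h = <-rec P step (h ∸ suc m) (m+[n∸m]≡n m<h)
      where
      P : ℕ → Set (c ⊔ ℓ)
      P d = ∀ {m} → suc m + d ≡ h → EqualSumsMeet (suc m)

      step : ∀ d → (∀ {d′} → d′ < d → P d′) → P d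
      step d rec {m} m+d≡h with d <? k
      ... | yes d<k = equalSumsMeet-pad (≡.subst (λ h → IsBhk G h k A) (≡.sym m+d≡h) bhk) d<k
      ... | no  d≮k = equalSumsMeet-halve (rec (∸-monoʳ-< z<s m<d) 2m+d′≡h)
        where
        m<d : suc m ≤ d
        m<d = m+n≤2*k⇒k≤n⇒m≤n (≤-trans (≤-reflexive m+d≡h) h≤2k) (≮⇒≥ d≮k)

        2m+d′≡h : suc m + suc m + (d ∸ suc m) ≡ h
        2m+d′≡h = ≡.trans (+-assoc (suc m) (suc m) (d ∸ suc m)) (≡.trans (≡.cong (suc m +_) (m+[n∸m]≡n m<d)) m+d≡h)

    equalSumsMeet⇒permutation : ∀ {h} → (∀ {m} → suc m ≤ h → EqualSumsMeet (suc m)) →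
                                ∀ {m} → m ≤ h → (b b′ : Vector Γ m) → b ⊆ᴬ A → b′ ⊆ᴬ A → sum b ≈ sum b′ →
                                Σ (Permutation′ m) λ π → ∀ x → b′ (π ⟨$⟩ʳ x) ≈ b x
    equalSumsMeet⇒permutation meets {zero}  _   b b′ _  _   _  = Perm.id , λ ()
    equalSumsMeet⇒permutation meets {suc m} m<h b b′ bA b′A eq with meets m<h b b′ bA b′A eq
    ... | j , i , b′j≈bi = insert i j π , insert-matches {b = b} {b′} π b′j≈bi matched
      where
      rest-eq : sum (removeAt b i) ≈ sum (removeAt b′ j)
      rest-eq = ∙-cancelˡ (b i) _ _ (begin
        b i ∙ sum (removeAt b i)    ≈⟨ sum-remove {i = i} b ⟨
        sum b                       ≈⟨ eq ⟩
        sum b′                      ≈⟨ sum-remove {i = j} b′ ⟩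
        b′ j ∙ sum (removeAt b′ j)  ≈⟨ ∙-congʳ b′j≈bi ⟩
        b i ∙ sum (removeAt b′ j)   ∎)

      rest = equalSumsMeet⇒permutation meets (≤-trans (n≤1+n m) m<h)
               (removeAt b i) (removeAt b′ j) (bA ∘ punchIn i) (b′A ∘ punchIn j) rest-eq
      π = proj₁ rest
      matched = proj₂ rest

    equalSumsMeet⇒IsBh : ∀ {h} → (∀ {m} → suc m ≤ h → EqualSumsMeet (suc m)) → IsBh G h A
    equalSumsMeet⇒IsBh meets a a′ aA a′A eq
      with equalSumsMeet⇒permutation meets ≤-refl a a′ aA a′A (sumT≈⇒sum≈ a a′ eq)
    ... | π , matched = id , π ⟨$⟩ʳ_ , id , Injection.injective (↔⇒↣ π) , matched

mainTheorem1 : ∀ {c ℓ ℓx : Level} (G : AbelianGroup c ℓ)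
                 (X : AbelianGroup.Carrier G → Set ℓx) (h k : ℕ) →
                 2 ≤ h → h ≤ 2 * k → k ≤ h →
                 (A : List (AbelianGroup.Carrier G)) →
                 (InBh G X h A → InBhk G X h k A) × (InBhk G X h k A → InBh G X h A)
mainTheorem1 G X h k _ h≤2k k≤h A =
  map₂ (IsBhk-mono G k≤h) ,
  map₂ (λ bhk → equalSumsMeet⇒IsBh G (IsBhk⇒equalSumsMeet G bhk h≤2k))
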